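{- Let $b,c_1,c_2$ be positive integers, let $\alpha/\beta$ be the right lobster $\mathcal{L}^{c_1,c_2}_b$, and let $T$ be a minimal element of the poset $\mathrm{SET}(\alpha/\beta)$. Then the entries of the cells in any given column of $T$ form an interval of consecutive integers.
   Context: Compositions, diagrams (rows numbered from bottom, columns from left), and skew diagrams $\alpha/\beta$ for compositions $\beta\subseteq\alpha$ are as usual: $\alpha/\beta$ is the set of cells of the diagram of $\alpha$ (with $\alpha_i$ left-justified cells in row $i$) not in that of $\beta$. The right lobster $\mathcal{L}^{c_1,c_2}_b$ is $\alpha/\beta$ with $\alpha=(b+1+c_2,b+1,b+1+c_1)$, $\beta=(b+1,1,b+1)$: a top row (claw) of $c_1$ cells and a bottom row (claw) of $c_2$ cells, both starting at column $b+2$, and a middle row (body) of $b$ cells in columns $2,\ldots,b+1$. Let $n=b+c_1+c_2$. A standard extended tableau is a bijective filling of the cells with $1,\ldots,n$ strictly increasing left to right along rows and bottom to top along columns; $\mathrm{SET}(\alpha/\beta)$ denotes the set of these. For $1\le i\le n-1$, $\pi_i(T)=T$ if $i+1$ is in a strictly higher row than $i$, $\pi_i(T)=s_i(T)$ (swap $i$ and $i+1$) if $i+1$ is in a strictly lower row than $i$, and $\pi_i(T)=0$ if they are in the same row. Poset on $\mathrm{SET}(\alpha/\beta)$: $S\le T$ iff $T$ is obtained from $S$ by a finite sequence of operators $\pi_i$ with all intermediate results nonzero. -}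

module Defs where

open import Data.Nat using (ℕ; zero; suc; _+_; _≤_; _<_)
open import Data.Nat.Properties using (≤-trans; n≤1+n)
open import Data.Fin as Fin using (Fin; fromℕ<)
open import Data.Vec using (Vec; lookup; _[_]≔_)
open import Data.List using (List; []; _∷_)
open import Data.Product using (_×_; _,_; proj₁; proj₂; ∃)
open import Data.Maybe using (Maybe; just; nothing)
open import Relation.Binary.PropositionalEquality using (_≡_)
open import Relation.Nullary using (yes; no)
open import Relation.Binary.Construct.Closure.ReflexiveTransitive using (Star)

-- A cell is (row , column); rows numbered from the bottom, columns from the left, both from 1.
Cell : Set
Cell = ℕ × ℕ

row : Cell → ℕ
row = proj₁

col : Cell → ℕ
col = proj₂

-- i-th part (1-based) of a composition, 0 beyond its length
part : List ℕ → ℕ → ℕ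
part []       _             = 0
part (_ ∷ _)  zero          = 0
part (a ∷ _)  (suc zero)    = a
part (_ ∷ as) (suc (suc i)) = part as (suc i)

InSkew : List ℕ → List ℕ → Cell → Set
InSkew α β (r , c) = (1 ≤ r) × (part β r < c) × (c ≤ part α r)

-- A bijective filling of α/β by 1..n is encoded by T : Vec Cell n, where
-- lookup T k is the cell containing the entry (toℕ k + 1).
record IsSET (α β : List ℕ) {n : ℕ} (T : Vec Cell n) : Set where
  field
    inShape  : ∀ k → InSkew α β (lookup T k)
    injective : ∀ k l → lookup T k ≡ lookup T l → k ≡ l
    surjective : ∀ x → InSkew α β x → ∃ λ k → lookup T k ≡ x
    rowIncr  : ∀ k l → row (lookup T k) ≡ row (lookup T l) →
               col (lookup T k) < col (lookup T l) → k Fin.< l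
    colIncr  : ∀ k l → col (lookup T k) ≡ col (lookup T l) →
               row (lookup T k) < row (lookup T l) → k Fin.< l

sk<n⇒k<n : ∀ {k n} → suc k < n → k < n
sk<n⇒k<n {k} p = ≤-trans (n≤1+n (suc k)) p

-- π_i with i = suc k (so 1 ≤ i ≤ n-1); nothing encodes the result 0.
π : ∀ {n} (k : ℕ) → suc k < n → Vec Cell n → Maybe (Vec Cell n)
π {n} k p T with Data.Nat._<?_ (row a) (row b) | Data.Nat._<?_ (row b) (row a)
  where
    i = fromℕ< (sk<n⇒k<n p)
    j = fromℕ< p
    a = lookup T i
    b = lookup T j
... | yes _ | _     = just T
... | no _  | yes _ = just ((T [ fromℕ< (sk<n⇒k<n p) ]≔ lookup T (fromℕ< p)) [ fromℕ< p ]≔ lookup T (fromℕ< (sk<n⇒k<n p)))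
... | no _  | no _  = nothing

Step : ∀ {n} → Vec Cell n → Vec Cell n → Set
Step {n} S T = ∃ λ k → ∃ λ (p : suc k < n) → π k p S ≡ just T

-- S ≤ T in the poset SET(α/β)
_≼_ : ∀ {n} → Vec Cell n → Vec Cell n → Set
S ≼ T = Star Step S T

IsMinimal : (α β : List ℕ) {n : ℕ} → Vec Cell n → Set
IsMinimal α β {n} T = ∀ (S : Vec Cell n) → IsSET α β S → S ≼ T → S ≡ T

lobsterα lobsterβ : ℕ → ℕ → ℕ → List ℕ
lobsterα b c₁ c₂ = (b + 1 + c₂) ∷ (b + 1) ∷ (b + 1 + c₁) ∷ []
lobsterβ b c₁ c₂ = (b + 1) ∷ 1 ∷ (b + 1) ∷ []

-- In a minimal tableau every ascent (i + 1 in a higher row than i) is vertical: otherwise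
-- swapping i and i + 1 gives a standard extended tableau strictly below it. In the lobster a
-- column holding two cells has them in rows 1 and 3. Between the two entries of such a column
-- there is an ascent, which is then vertical, hence also spans rows 1 and 3; row-strictness in
-- the two claws forces it to be the given column, so its entries are consecutive.
module Submission where

open import Defs
open import Data.Nat using (ℕ; zero; suc; z≤n; s≤s; _+_; _≤_; _<_; _<?_; s≤s⁻¹)
open import Data.Nat.Properties
  using ( ≤-reflexive; ≤-trans; ≤-<-trans; <⇒≤; ≤-antisym; <-irrefl; <-asym; <-trans; <-≤-trans; <-cmp; n<1+n
        ; m<n⇒m<1+n; m≤n⇒m<n∨m≡n; <⇒≢; <⇒≱; ≮⇒≥; ≤∧≢⇒<; 1+n≢n)
  renaming (_≟_ to _≟ℕ_)
open import Data.Fin as Fin using (Fin; toℕ; fromℕ<)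
open import Data.Fin.Properties using (_≟_; toℕ-injective; toℕ-fromℕ<; fromℕ<-toℕ; fromℕ<-cong; toℕ<n)
open import Data.Fin.Permutation.Components using (transpose; transpose-inverse)
open import Data.Vec using (Vec; lookup; tabulate; _[_]≔_)
open import Data.Vec.Properties using (lookup∘update; lookup∘update′; tabulate∘lookup; tabulate-cong; []≔-commutes)
open import Data.List using (List)
open import Data.Product using (_×_; _,_; proj₁; proj₂; ∃-syntax; ∃₂; curry; uncurry)
open import Data.Product.Properties using (×-≡,≡→≡)
open import Data.Sum using (_⊎_; inj₁; inj₂)
open import Data.Maybe using (just)
open import Function using (_∘_)
open import Relation.Binary using (tri<; tri≈; tri>)
open import Relation.Binary.PropositionalEquality
open import Relation.Nullary using (¬_; yes; no; contradiction)
open import Relation.Binary.Construct.Closure.ReflexiveTransitive using (ε; _◅_)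

private
  variable
    A : Set
    n : ℕ

_⋖_ : Fin n → Fin n → Set
i ⋖ j = toℕ j ≡ suc (toℕ i)

⋖⇒< : {i j : Fin n} → i ⋖ j → toℕ i < toℕ j
⋖⇒< {i = i} i⋖j = subst (toℕ i <_) (sym i⋖j) (n<1+n (toℕ i))

⋖⇒≢ : {i j : Fin n} → i ⋖ j → i ≢ j
⋖⇒≢ i⋖j refl = 1+n≢n (sym i⋖j)

ascent-ℕ : (f : ℕ → ℕ) {a l : ℕ} → a ≤ l → f a < f l → ∃[ k ] a ≤ k × k < l × f k < f (suc k)
ascent-ℕ f {l = zero} z≤n fa<fl = contradiction fa<fl (<-irrefl refl)
ascent-ℕ f {a} {suc l} a≤1+l fa<fl with m≤n⇒m<n∨m≡n a≤1+l
... | inj₂ refl = contradiction fa<fl (<-irrefl refl)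
... | inj₁ a<1+l with f l <? f (suc l)
...   | yes fl<f1+l = l , s≤s⁻¹ a<1+l , n<1+n l , fl<f1+l
...   | no fl≮f1+l with ascent-ℕ f (s≤s⁻¹ a<1+l) (<-≤-trans fa<fl (≮⇒≥ fl≮f1+l))
...     | k , a≤k , k<l , fk<f1+k = k , a≤k , m<n⇒m<1+n k<l , fk<f1+k

clamp : Fin n → ℕ → Fin n
clamp {n} d k with k <? n
... | yes k<n = fromℕ< k<n
... | no _    = d

toℕ-clamp : (d : Fin n) {k : ℕ} → k < n → toℕ (clamp d k) ≡ k
toℕ-clamp {n} d {k} k<n with k <? n
... | yes _   = toℕ-fromℕ< k<n
... | no k≮n = contradiction k<n k≮n

clamp-toℕ : (d x : Fin n) → clamp d (toℕ x) ≡ x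
clamp-toℕ d x = toℕ-injective (toℕ-clamp d (toℕ<n x))

ascent-Fin : (f : Fin n → ℕ) {a l : Fin n} → a Fin.≤ l → f a < f l →
             ∃₂ λ i j → i ⋖ j × a Fin.≤ i × j Fin.≤ l × f i < f j
ascent-Fin f {a} {l} a≤l fa<fl
  with ascent-ℕ (f ∘ clamp a) a≤l (subst₂ _<_ (cong f (sym (clamp-toℕ a a))) (cong f (sym (clamp-toℕ a l))) fa<fl)
... | k , a≤k , k<l , asc =
  clamp a k , clamp a (suc k) , trans (toℕ-clamp a 1+k<n) (cong suc (sym (toℕ-clamp a k<n)))
  , subst (toℕ a ≤_) (sym (toℕ-clamp a k<n)) a≤k
  , subst (_≤ toℕ l) (sym (toℕ-clamp a 1+k<n)) k<l
  , asc
  where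
    1+k<n = ≤-<-trans k<l (toℕ<n l)
    k<n   = <-trans (n<1+n k) 1+k<n

data Transposed (i j : Fin n) : Fin n → Fin n → Set where
  left  : Transposed i j i j
  right : Transposed i j j i
  fixed : ∀ {x} → x ≢ i → x ≢ j → Transposed i j x x

transposed : (i j x : Fin n) → Transposed i j x (transpose i j x)
transposed i j x with x ≟ i
... | yes refl = left
... | no x≢i with x ≟ j
...   | yes refl = right
...   | no x≢j   = fixed x≢i x≢j

transposed-monotone : {i j x x′ y y′ : Fin n} → i ⋖ j →
                      Transposed i j x x′ → Transposed i j y y′ → toℕ x′ < toℕ y′ →
                      toℕ x < toℕ y ⊎ (x′ ≡ i × y′ ≡ j)
transposed-monotone i⋖j left  left  j<j = contradiction j<j (<-irrefl refl)
transposed-monotone i⋖j left  right j<i = contradiction j<i (<-asym (⋖⇒< i⋖j))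
transposed-monotone i⋖j left  (fixed _ _) j<y = inj₁ (<-trans (⋖⇒< i⋖j) j<y)
transposed-monotone i⋖j right left  _ = inj₂ (refl , refl)
transposed-monotone i⋖j right right i<i = contradiction i<i (<-irrefl refl)
transposed-monotone i⋖j right (fixed _ y≢j) i<y =
  inj₁ (≤∧≢⇒< (subst (_≤ _) (sym i⋖j) i<y) (y≢j ∘ sym ∘ toℕ-injective))
transposed-monotone i⋖j (fixed x≢i _) left x<j =
  inj₁ (≤∧≢⇒< (s≤s⁻¹ (subst (_ <_) i⋖j x<j)) (x≢i ∘ toℕ-injective))
transposed-monotone i⋖j (fixed _ _) right x<i = inj₁ (<-trans x<i (⋖⇒< i⋖j))
transposed-monotone i⋖j (fixed _ _) (fixed _ _) x<y = inj₁ x<y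

swap : Fin n → Fin n → Vec A n → Vec A n
swap i j V = (V [ i ]≔ lookup V j) [ j ]≔ lookup V i

lookup-swap : {i j x x′ : Fin n} → i ≢ j → (V : Vec A n) →
              Transposed i j x x′ → lookup (swap i j V) x ≡ lookup V x′
lookup-swap {i = i} {j} i≢j V left =
  trans (lookup∘update′ i≢j (V [ i ]≔ lookup V j) (lookup V i)) (lookup∘update i V (lookup V j))
lookup-swap {i = i} {j} i≢j V right = lookup∘update j (V [ i ]≔ lookup V j) (lookup V i)
lookup-swap {i = i} {j} i≢j V (fixed x≢i x≢j) =
  trans (lookup∘update′ x≢j (V [ i ]≔ lookup V j) (lookup V i)) (lookup∘update′ x≢i V (lookup V j))

lookup-swap-transpose : {i j : Fin n} → i ≢ j → (V : Vec A n) (x : Fin n) →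
                        lookup (swap i j V) x ≡ lookup V (transpose i j x)
lookup-swap-transpose {i = i} {j} i≢j V x = lookup-swap i≢j V (transposed i j x)

lookup-extensional : {V W : Vec A n} → (∀ x → lookup V x ≡ lookup W x) → V ≡ W
lookup-extensional {V = V} {W} eq = begin
  V                ≡⟨ tabulate∘lookup V ⟨
  tabulate (lookup V) ≡⟨ tabulate-cong eq ⟩
  tabulate (lookup W) ≡⟨ tabulate∘lookup W ⟩
  W                ∎
  where open ≡-Reasoning

swap-involutive : {i j : Fin n} → i ≢ j → (V : Vec A n) → swap i j (swap i j V) ≡ V
swap-involutive {i = i} {j} i≢j V = lookup-extensional λ x → begin
  lookup (swap i j (swap i j V)) x     ≡⟨ cong (λ W → lookup W x) (swap-comm (swap i j V)) ⟩
  lookup (swap j i (swap i j V)) x     ≡⟨ lookup-swap-transpose (i≢j ∘ sym) (swap i j V) x ⟩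
  lookup (swap i j V) (transpose j i x) ≡⟨ lookup-swap-transpose i≢j V (transpose j i x) ⟩
  lookup V (transpose i j (transpose j i x)) ≡⟨ cong (lookup V) (transpose-inverse i j) ⟩
  lookup V x                           ∎
  where
    open ≡-Reasoning
    swap-comm : (W : Vec A _) → swap i j W ≡ swap j i W
    swap-comm W = []≔-commutes W i j i≢j

Increasing : (A → A → Set) → Vec A n → Set
Increasing R V = ∀ x y → R (lookup V x) (lookup V y) → x Fin.< y

swap-increasing : {i j : Fin n} → i ⋖ j → (R : A → A → Set) (V : Vec A n) →
                  Increasing R V → ¬ R (lookup V i) (lookup V j) → Increasing R (swap i j V)
swap-increasing {i = i} {j} i⋖j R V inc ¬Rij x y Rxy =
  through (transposed i j x) (transposed i j y)
    (subst₂ R (lookup-swap-transpose i≢j V x) (lookup-swap-transpose i≢j V y) Rxy)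
  where
    i≢j = ⋖⇒≢ i⋖j
    through : ∀ {x′ y′} → Transposed i j x x′ → Transposed i j y y′ →
              R (lookup V x′) (lookup V y′) → x Fin.< y
    through tx ty Rx′y′ with transposed-monotone i⋖j tx ty (inc _ _ Rx′y′)
    ... | inj₁ x<y          = x<y
    ... | inj₂ (refl , refl) = contradiction Rx′y′ ¬Rij

module _ {α β : List ℕ} {T : Vec Cell n} (isT : IsSET α β T) where
  open IsSET isT

  swap-IsSET : {i j : Fin n} → i ⋖ j →
               row (lookup T i) ≢ row (lookup T j) → col (lookup T i) ≢ col (lookup T j) →
               IsSET α β (swap i j T)
  swap-IsSET {i} {j} i⋖j rows≢ cols≢ = record
    { inShape    = λ x → subst (InSkew α β) (sym (lookup-swap-transpose i≢j T x)) (inShape (transpose i j x))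
    ; injective  = λ x y Sx≡Sy → begin
        x                                    ≡⟨ transpose-inverse j i ⟨
        transpose j i (transpose i j x)      ≡⟨ cong (transpose j i) (injective _ _ (begin
          lookup T (transpose i j x) ≡⟨ lookup-swap-transpose i≢j T x ⟨
          lookup (swap i j T) x      ≡⟨ Sx≡Sy ⟩
          lookup (swap i j T) y      ≡⟨ lookup-swap-transpose i≢j T y ⟩
          lookup T (transpose i j y) ∎)) ⟩
        transpose j i (transpose i j y)      ≡⟨ transpose-inverse j i ⟩
        y                                    ∎
    ; surjective = λ c c∈α/β → let (k , Tk≡c) = surjective c c∈α/β in
        transpose j i k ,
        trans (lookup-swap-transpose i≢j T _) (trans (cong (lookup T) (transpose-inverse i j)) Tk≡c)
    ; rowIncr    = λ x y → curry (swap-increasing i⋖j LeftInRow T (λ x y → uncurry (rowIncr x y))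
                                   (λ (e , _) → rows≢ e) x y)
    ; colIncr    = λ x y → curry (swap-increasing i⋖j BelowInColumn T (λ x y → uncurry (colIncr x y))
                                   (λ (e , _) → cols≢ e) x y)
    }
    where
      open ≡-Reasoning
      i≢j = ⋖⇒≢ i⋖j
      LeftInRow BelowInColumn : Cell → Cell → Set
      LeftInRow a c = row a ≡ row c × col a < col c
      BelowInColumn a c = col a ≡ col c × row a < row c

π-descent : (k : ℕ) (p : suc k < n) (S : Vec Cell n) →
            row (lookup S (fromℕ< p)) < row (lookup S (fromℕ< (sk<n⇒k<n p))) →
            π k p S ≡ just (swap (fromℕ< (sk<n⇒k<n p)) (fromℕ< p) S)
π-descent k p S descent
  with row (lookup S (fromℕ< (sk<n⇒k<n p))) <? row (lookup S (fromℕ< p))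
     | row (lookup S (fromℕ< p)) <? row (lookup S (fromℕ< (sk<n⇒k<n p)))
... | yes ascent | _          = contradiction descent (<-asym ascent)
... | no _       | yes _      = refl
... | no _       | no ¬descent = contradiction descent ¬descent

descent-Step : {i j : Fin n} (S : Vec Cell n) → i ⋖ j →
               row (lookup S j) < row (lookup S i) → Step S (swap i j S)
descent-Step {n} {i} {j} S i⋖j descent =
  toℕ i , p , subst₂ (λ a c → π (toℕ i) p S ≡ just (swap a c S)) i′≡i j′≡j
    (π-descent (toℕ i) p S (subst₂ (λ a c → row (lookup S c) < row (lookup S a)) (sym i′≡i) (sym j′≡j) descent))
  where
    p : suc (toℕ i) < n
    p = subst (_< n) i⋖j (toℕ<n j)
    i′≡i : fromℕ< (sk<n⇒k<n p) ≡ i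
    i′≡i = fromℕ<-toℕ i _
    j′≡j : fromℕ< p ≡ j
    j′≡j = trans (fromℕ<-cong _ _ (sym i⋖j) p (toℕ<n j)) (fromℕ<-toℕ j _)

minimal-ascent-vertical : {α β : List ℕ} {T : Vec Cell n} → IsSET α β T → IsMinimal α β T →
                          {i j : Fin n} → i ⋖ j → row (lookup T i) < row (lookup T j) →
                          col (lookup T i) ≡ col (lookup T j)
minimal-ascent-vertical {T = T} isT minT {i} {j} i⋖j ascent with col (lookup T i) ≟ℕ col (lookup T j)
... | yes cols≡ = cols≡
... | no cols≢  = contradiction (IsSET.injective isT i j Ti≡Tj) (⋖⇒≢ i⋖j)
  where
    i≢j = ⋖⇒≢ i⋖j
    S = swap i j T
    S↝T : Step S T
    S↝T = subst (Step S) (swap-involutive i≢j T)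
      (descent-Step S i⋖j (subst₂ (λ a c → row a < row c)
        (sym (lookup-swap i≢j T right)) (sym (lookup-swap i≢j T left)) ascent))
    S≡T : S ≡ T
    S≡T = minT S (swap-IsSET isT i⋖j (<⇒≢ ascent) cols≢) (S↝T ◅ ε)
    Ti≡Tj : lookup T i ≡ lookup T j
    Ti≡Tj = trans (cong (λ V → lookup V i) (sym S≡T)) (lookup-swap i≢j T left)

module _ {α β : List ℕ} {T : Vec Cell n} (isT : IsSET α β T) where
  open IsSET isT

  same-cell : {k l : Fin n} → row (lookup T k) ≡ row (lookup T l) → col (lookup T k) ≡ col (lookup T l) → k ≡ l
  same-cell rows≡ cols≡ = injective _ _ (×-≡,≡→≡ (rows≡ , cols≡))

  column-rows-increasing : {k l : Fin n} → col (lookup T k) ≡ col (lookup T l) → k Fin.< l →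
                           row (lookup T k) < row (lookup T l)
  column-rows-increasing {k} {l} cols≡ k<l with <-cmp (row (lookup T k)) (row (lookup T l))
  ... | tri< below _ _ = below
  ... | tri≈ _ rows≡ _ = contradiction (cong toℕ (same-cell rows≡ cols≡)) (<⇒≢ k<l)
  ... | tri> _ _ above = contradiction (colIncr l k (sym cols≡) above) (<-asym k<l)

lobster-column : {b c₁ c₂ : ℕ} {x y : Cell} →
                 InSkew (lobsterα b c₁ c₂) (lobsterβ b c₁ c₂) x →
                 InSkew (lobsterα b c₁ c₂) (lobsterβ b c₁ c₂) y →
                 col x ≡ col y → row x < row y → row x ≡ 1 × row y ≡ 3
lobster-column {x = 1 , _} {3 , _} _ _ _ _ = refl , refl
lobster-column {x = 1 , _} {2 , _} (_ , claw , _) (_ , _ , body) refl _ = contradiction body (<⇒≱ claw)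
lobster-column {x = 2 , _} {3 , _} (_ , _ , body) (_ , claw , _) refl _ = contradiction body (<⇒≱ claw)
lobster-column {y = suc (suc (suc (suc _))) , _} _ (_ , s≤s _ , ()) _ _
lobster-column {x = 1 , _}                 {1 , _} _ _ _ (s≤s ())
lobster-column {x = suc (suc _) , _}       {1 , _} _ _ _ (s≤s ())
lobster-column {x = suc (suc _) , _}       {2 , _} _ _ _ (s≤s (s≤s ()))
lobster-column {x = suc (suc (suc _)) , _} {3 , _} _ _ _ (s≤s (s≤s (s≤s ())))

module _ {b c₁ c₂ : ℕ} {T : Vec Cell n}
         (isT : IsSET (lobsterα b c₁ c₂) (lobsterβ b c₁ c₂) T)
         (minT : IsMinimal (lobsterα b c₁ c₂) (lobsterβ b c₁ c₂) T) where
  open IsSET isT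

  lobster-column-rows : {k l : Fin n} → col (lookup T k) ≡ col (lookup T l) → k Fin.< l →
                   row (lookup T k) ≡ 1 × row (lookup T l) ≡ 3
  lobster-column-rows {k} {l} cols≡ k<l =
    lobster-column (inShape k) (inShape l) cols≡ (column-rows-increasing isT cols≡ k<l)

  column-entries-consecutive : {k l : Fin n} → col (lookup T k) ≡ col (lookup T l) → k Fin.< l → k ⋖ l
  column-entries-consecutive {k} {l} colk≡coll k<l
    with ascent-Fin (row ∘ lookup T) (<⇒≤ k<l) (column-rows-increasing isT colk≡coll k<l)
  ... | i , j , i⋖j , k≤i , j≤l , ascent = begin
    toℕ l       ≡⟨ cong toℕ (same-cell isT (trans rowj≡3 (sym rowl≡3)) colj≡coll) ⟨
    toℕ j       ≡⟨ i⋖j ⟩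
    suc (toℕ i) ≡⟨ cong (suc ∘ toℕ) (same-cell isT (trans rowi≡1 (sym rowk≡1)) coli≡colk) ⟩
    suc (toℕ k) ∎
    where
      open ≡-Reasoning
      rowk≡1 = proj₁ (lobster-column-rows colk≡coll k<l)
      rowl≡3 = proj₂ (lobster-column-rows colk≡coll k<l)
      coli≡colj = minimal-ascent-vertical isT minT i⋖j ascent
      rowi≡1 = proj₁ (lobster-column-rows coli≡colj (⋖⇒< i⋖j))
      rowj≡3 = proj₂ (lobster-column-rows coli≡colj (⋖⇒< i⋖j))
      colk≤coli : col (lookup T k) ≤ col (lookup T i)
      colk≤coli = ≮⇒≥ λ coli<colk → <⇒≱ (rowIncr i k (trans rowi≡1 (sym rowk≡1)) coli<colk) k≤i
      colj≤coll : col (lookup T j) ≤ col (lookup T l)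
      colj≤coll = ≮⇒≥ λ coll<colj → <⇒≱ (rowIncr l j (trans rowl≡3 (sym rowj≡3)) coll<colj) j≤l
      coli≡colk : col (lookup T i) ≡ col (lookup T k)
      coli≡colk = ≤-antisym
        (≤-trans (subst (_≤ _) (sym coli≡colj) colj≤coll) (≤-reflexive (sym colk≡coll)))
        colk≤coli
      colj≡coll : col (lookup T j) ≡ col (lookup T l)
      colj≡coll = trans (sym coli≡colj) (trans coli≡colk colk≡coll)

lemma21 : (b c₁ c₂ : ℕ) → 1 ≤ b → 1 ≤ c₁ → 1 ≤ c₂ →
          (T : Vec Cell (b + c₁ + c₂)) →
          IsSET (lobsterα b c₁ c₂) (lobsterβ b c₁ c₂) T →
          IsMinimal (lobsterα b c₁ c₂) (lobsterβ b c₁ c₂) T →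
          ∀ (k l m : Fin (b + c₁ + c₂)) →
          col (lookup T k) ≡ col (lookup T l) →
          k Fin.≤ m → m Fin.≤ l →
          col (lookup T m) ≡ col (lookup T k)
lemma21 b c₁ c₂ _ _ _ T isT minT k l m colk≡coll k≤m m≤l with toℕ k ≟ℕ toℕ m
... | yes k≡m = cong (col ∘ lookup T) (toℕ-injective (sym k≡m))
... | no k≢m  = trans (cong (col ∘ lookup T) m≡l) (sym colk≡coll)
  where
    k<m = ≤∧≢⇒< k≤m k≢m
    k⋖l = column-entries-consecutive isT minT colk≡coll (<-≤-trans k<m m≤l)
    m≡l = toℕ-injective (≤-antisym m≤l (subst (_≤ toℕ m) (sym k⋖l) k<m))
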